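{- Let $m \geq 2$ and $k\geq 2$ be integers, and let $T$ be a perfect $m$-ary tree of depth $d\leq k$. Then $\gamma_{all,k}^\infty(T) = 1$ if $d \leq \frac{k}{2}$, and $\gamma_{all,k}^\infty(T) = 2$ if $d > \frac{k}{2}$.
   Context: A perfect $m$-ary tree of depth $d$ is a rooted tree in which every non-leaf vertex has exactly $m$ children and every leaf is at distance exactly $d$ from the root. Graphs are finite and simple; $d(u,v)$ is graph distance and $N_k[x]=\{v: d(x,v)\le k\}$. A multiset $D$ of vertices of $G$ is a distance-$k$ dominating set if every vertex of $V(G)\setminus D$ is at distance at most $k$ from some element of $D$. Let $\mathbb{D}_{k,q}(G)$ be the set of such multisets of cardinality $q$. $D=\{v_1,\dots,v_q\}$ transforms to $D'=\{u_1,\dots,u_q\}$ if (for some indexing) $u_i\in N_k[v_i]$ for all $i$. An eternal distance-$k$ dominating family is $\mathcal{E}\subseteq\mathbb{D}_{k,q}(G)$ for some $q$ such that for every $D\in\mathcal{E}$ and every vertex $v$ there is $D'\in\mathcal{E}$ with $v\in D'$ and $D$ transforms to $D'$. $\gamma_{all,k}^\infty(G)$ is the minimum $q$ for which such a family exists. -}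

module Defs where

open import Data.Nat using (ℕ; zero; suc; _+_; _*_; _≤_; _<_)
open import Data.Fin using (Fin)
open import Data.List using (List; length; _∷_)
open import Data.Vec using (Vec; lookup)
open import Data.Product using (Σ; ∃; ∃-syntax; _×_; _,_; proj₁)
open import Data.Sum using (_⊎_)
open import Relation.Nullary using (¬_)
open import Relation.Binary.PropositionalEquality using (_≡_)
open import Function.Bundles using (_↔_; Inverse)

record Graph : Set₁ where
  field
    V   : Set
    Adj : V → V → Set

module _ (G : Graph) where
  open Graph G

  data Walk : ℕ → V → V → Set where
    here : ∀ {u} → Walk zero u u
    step : ∀ {n u w v} → Adj u w → Walk n w v → Walk (suc n) u v

  DistLE : ℕ → V → V → Set
  DistLE k u v = ∃[ n ] (n ≤ k × Walk n u v)

  -- a multiset of q vertices, represented by an indexing Fin q → V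
  _∈ₘ_ : ∀ {q} → V → Vec V q → Set
  v ∈ₘ D = ∃[ i ] (lookup D i ≡ v)

  Dominating : ℕ → ∀ {q} → Vec V q → Set
  Dominating k {q} D = ∀ v → ¬ (v ∈ₘ D) → ∃[ i ] DistLE k (lookup D i) v

  Transforms : ℕ → ∀ {q} → Vec V q → Vec V q → Set
  Transforms k {q} D D' =
    Σ (Fin q ↔ Fin q) λ σ → ∀ i → DistLE k (lookup D i) (lookup D' (Inverse.to σ i))

  IsEternalFamily : ℕ → (q : ℕ) → (Vec V q → Set) → Set
  IsEternalFamily k q E =
    (∃[ D ] E D)
    × (∀ D → E D → Dominating k D)
    × (∀ D → E D → ∀ v → ∃[ D' ] (E D' × v ∈ₘ D' × Transforms k D D'))

  HasEternalFamily : ℕ → ℕ → Set₁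
  HasEternalFamily k q = ∃[ E ] IsEternalFamily k q E

  EternalDomNumber≡ : ℕ → ℕ → Set₁
  EternalDomNumber≡ k q = HasEternalFamily k q × (∀ q' → q' < q → ¬ HasEternalFamily k q')

-- The perfect m-ary tree of depth d: vertices are words over Fin m of length ≤ d
-- (the path from the root, most recent choice first); a word is adjacent to
-- its one-letter extensions (children) and to its parent.
PerfectTreeV : ℕ → ℕ → Set
PerfectTreeV m d = Σ (List (Fin m)) λ w → length w ≤ d

PerfectTree : ℕ → ℕ → Graph
PerfectTree m d = record
  { V   = PerfectTreeV m d
  ; Adj = λ u v → (∃[ i ] (proj₁ v ≡ i ∷ proj₁ u)) ⊎ (∃[ i ] (proj₁ u ≡ i ∷ proj₁ v))
  }

-- If 2d ≤ k the tree has diameter at most k, so a single guard can answer any request.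
-- If 2d > k, every vertex is still within d ≤ k of the root, so a guard parked at the root
-- plus one responder suffice; but a single guard fails, because two leaves in different
-- subtrees of the root are at distance 2d > k.
module Submission where

open import Defs
open import Data.Nat using (ℕ; zero; suc; _+_; _*_; _∸_; _≤_; _<_; _>_; z≤n; s≤s)
open import Data.Nat.Properties
open import Data.Fin using (Fin; zero; suc)
open import Data.Fin.Permutation using (transpose)
open import Data.List using ([]; _∷_; length; replicate; last)
open import Data.List.Properties using (length-replicate)
open import Data.Maybe using (Maybe; just; nothing)
open import Data.Vec using (Vec; []; _∷_; lookup)
open import Data.Product using (∃-syntax; _×_; _,_; proj₁; proj₂)
open import Data.Sum using (inj₁; inj₂)
open import Data.Unit using (⊤; tt)
open import Function.Bundles using (Inverse)
open import Function.Properties.Inverse using (↔-refl)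
open import Relation.Nullary using (¬_)
open import Relation.Binary.PropositionalEquality

module WalkProperties (G : Graph) where
  open Graph G

  _++ʷ_ : ∀ {a b u v w} → Walk G a u v → Walk G b v w → Walk G (a + b) u w
  here     ++ʷ q = q
  step e p ++ʷ q = step e (p ++ʷ q)

  snocʷ : ∀ {n u v w} → Walk G n u v → Adj v w → Walk G (suc n) u w
  snocʷ here       e = step e here
  snocʷ (step f p) e = step f (snocʷ p e)

  reverseʷ : (∀ {u v} → Adj u v → Adj v u) → ∀ {n u v} → Walk G n u v → Walk G n v u
  reverseʷ sym here       = here
  reverseʷ sym (step e p) = snocʷ (reverseʷ sym p) (sym e)

  walk-potential : (f : V → ℕ) → (∀ {u v} → Adj u v → f u ≤ suc (f v)) →
                   ∀ {n u v} → Walk G n u v → f u ≤ n + f v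
  walk-potential f lip here       = ≤-refl
  walk-potential f lip (step e p) = ≤-trans (lip e) (s≤s (walk-potential f lip p))

module EternalFamilies (G : Graph) (k : ℕ) where
  open Graph G

  noEternalFamily₀ : V → ¬ HasEternalFamily G k 0
  noEternalFamily₀ v (E , (D , D∈E) , dom , _) with dom D D∈E v (λ { (() , _) })
  ... | () , _

  eternalFamily₁ : V → (∀ u v → DistLE G k u v) → HasEternalFamily G k 1
  eternalFamily₁ v₀ diam = (λ _ → ⊤) , ((v₀ ∷ []) , tt) , dom , move
    where
    dom : ∀ D → ⊤ → Dominating G k D
    dom (u ∷ []) _ v _ = zero , diam u v
    move : ∀ D → ⊤ → ∀ v → ∃[ D' ] (⊤ × _∈ₘ_ G v D' × Transforms G k D D')
    move (u ∷ []) _ v = (v ∷ []) , tt , (zero , refl) , ↔-refl , λ { zero → diam u v }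

  -- One guard stays on a centre r; the other answers any request, after which the two swap roles.
  eternalFamily₂ : (r : V) → (∀ v → DistLE G k r v) → (∀ v → DistLE G k v r) →
                   HasEternalFamily G k 2
  eternalFamily₂ r from-r to-r = AtCentre , ((r ∷ r ∷ []) , refl) , dom , move
    where
    AtCentre : Vec V 2 → Set
    AtCentre D = lookup D zero ≡ r
    dom : ∀ D → AtCentre D → Dominating G k D
    dom D refl v _ = zero , from-r v
    move : ∀ D → AtCentre D → ∀ v →
           ∃[ D' ] (AtCentre D' × _∈ₘ_ G v D' × Transforms G k D D')
    move (_ ∷ b ∷ []) refl v =
      (r ∷ v ∷ []) , refl , (suc zero , refl) , transpose zero (suc zero) ,
      λ { zero → from-r v ; (suc zero) → to-r b }

  -- A lone guard must be able to reach u and then, in one move, v.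
  noEternalFamily₁ : (u v : V) → ¬ DistLE G k u v → ¬ HasEternalFamily G k 1
  noEternalFamily₁ u v far (_ , (D , D∈E) , _ , move)
    with move D D∈E u
  ... | (_ ∷ []) , D₁∈E , (zero , refl) , _
    with move (u ∷ []) D₁∈E v
  ... | (_ ∷ []) , _ , (zero , refl) , σ , reach = far (reach-only (Inverse.to σ zero) (reach zero))
    where
    reach-only : ∀ i → DistLE G k u (lookup (v ∷ []) i) → DistLE G k u v
    reach-only zero u→v = u→v

  eternalDomNumber≡1 : V → HasEternalFamily G k 1 → EternalDomNumber≡ G k 1
  eternalDomNumber≡1 v has₁ = has₁ , λ { zero _ → noEternalFamily₀ v ; (suc _) (s≤s ()) }

  eternalDomNumber≡2 : V → HasEternalFamily G k 2 → ¬ HasEternalFamily G k 1 →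
                       EternalDomNumber≡ G k 2
  eternalDomNumber≡2 v has₂ ¬has₁ =
    has₂ , λ { zero _ → noEternalFamily₀ v ; (suc zero) _ → ¬has₁ ; (suc (suc _)) (s≤s (s≤s ())) }

module PerfectTreeDistances (m d : ℕ) where
  open WalkProperties (PerfectTree m d)

  root : PerfectTreeV m d
  root = [] , z≤n

  depth : PerfectTreeV m d → ℕ
  depth (w , _) = length w

  adj-sym : ∀ {u v} → Graph.Adj (PerfectTree m d) u v → Graph.Adj (PerfectTree m d) v u
  adj-sym (inj₁ child)  = inj₂ child
  adj-sym (inj₂ parent) = inj₁ parent

  walk-to-root : ∀ w (∣w∣≤d : length w ≤ d) → Walk (PerfectTree m d) (length w) (w , ∣w∣≤d) root
  walk-to-root []      z≤n     = here
  walk-to-root (i ∷ w) ∣i∷w∣≤d = step (inj₂ (i , refl)) (walk-to-root w (m+n≤o⇒n≤o 1 ∣i∷w∣≤d))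

  distLE-via-root : ∀ k u v → depth u + depth v ≤ k → DistLE (PerfectTree m d) k u v
  distLE-via-root k (u , ∣u∣≤d) (v , ∣v∣≤d) ≤k =
    length u + length v , ≤k ,
    walk-to-root u ∣u∣≤d ++ʷ reverseʷ (λ {x} {y} → adj-sym {x} {y}) (walk-to-root v ∣v∣≤d)

  distLE-from-root : ∀ k → d ≤ k → ∀ v → DistLE (PerfectTree m d) k root v
  distLE-from-root k d≤k v = distLE-via-root k root v (≤-trans (proj₂ v) d≤k)

  distLE-to-root : ∀ k → d ≤ k → ∀ v → DistLE (PerfectTree m d) k v root
  distLE-to-root k d≤k v =
    distLE-via-root k v root (≤-trans (≤-reflexive (+-identityʳ (depth v))) (≤-trans (proj₂ v) d≤k))

  distLE-diameter : ∀ k → 2 * d ≤ k → ∀ u v → DistLE (PerfectTree m d) k u v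
  distLE-diameter k 2d≤k u v =
    distLE-via-root k u v (≤-trans (+-mono-≤ (proj₂ u) (≤-trans (proj₂ v) (m≤m+n d 0))) 2d≤k)

∸-suc-≤ : ∀ m n → m ∸ n ≤ suc (m ∸ suc n)
∸-suc-≤ zero    zero    = z≤n
∸-suc-≤ zero    (suc n) = z≤n
∸-suc-≤ (suc m) zero    = ≤-refl
∸-suc-≤ (suc m) (suc n) = ∸-suc-≤ m n

last-replicate : ∀ {a} {A : Set a} (x : A) n → last (x ∷ replicate n x) ≡ just x
last-replicate x zero    = refl
last-replicate x (suc n) = last-replicate x n

-- Depth counted positively in the subtree of the first child and negatively elsewhere
-- (shifted by d to stay in ℕ) changes by at most one along each edge, and differs by 2d
-- between a leaf of that subtree and a leaf outside it.
module SignedDepth (m d : ℕ) where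
  open WalkProperties (PerfectTree (suc m) d)

  signedDepth : Maybe (Fin (suc m)) → ℕ → ℕ
  signedDepth (just zero) l = l + d
  signedDepth _           l = d ∸ l

  potential : PerfectTreeV (suc m) d → ℕ
  potential (w , _) = signedDepth (last w) (length w)

  Near : ℕ → ℕ → Set
  Near a b = a ≤ suc b × b ≤ suc a

  signedDepth-zero : ∀ b → signedDepth b 0 ≡ d
  signedDepth-zero nothing        = refl
  signedDepth-zero (just zero)    = refl
  signedDepth-zero (just (suc _)) = refl

  signedDepth-suc : ∀ b l → Near (signedDepth b l) (signedDepth b (suc l))
  signedDepth-suc nothing        l = ∸-suc-≤ d l , ≤-trans (∸-monoʳ-≤ d (n≤1+n l)) (n≤1+n _)
  signedDepth-suc (just zero)    l = ≤-trans (n≤1+n _) (n≤1+n _) , ≤-refl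
  signedDepth-suc (just (suc _)) l = ∸-suc-≤ d l , ≤-trans (∸-monoʳ-≤ d (n≤1+n l)) (n≤1+n _)

  -- Below the root the branch of a word does not change when a letter is prepended.
  signedDepth-child : ∀ i w →
    Near (signedDepth (last w) (length w)) (signedDepth (last (i ∷ w)) (suc (length w)))
  signedDepth-child i []      = subst (λ s → Near s (signedDepth (just i) 1))
                                      (signedDepth-zero (just i)) (signedDepth-suc (just i) 0)
  signedDepth-child i (j ∷ w) = signedDepth-suc (last (j ∷ w)) (length (j ∷ w))

  potential-adj : ∀ {u v} → Graph.Adj (PerfectTree (suc m) d) u v → potential u ≤ suc (potential v)
  potential-adj {u , _} (inj₁ (i , refl)) = proj₁ (signedDepth-child i u)
  potential-adj {_ , _} {v , _} (inj₂ (i , refl)) = proj₂ (signedDepth-child i v)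

  leaf : Fin (suc m) → PerfectTreeV (suc m) d
  leaf i = replicate d i , ≤-reflexive (length-replicate d)

  signedDepth-replicate-zero : ∀ n → signedDepth (last (replicate n zero)) n ≡ n + d
  signedDepth-replicate-zero zero    = refl
  signedDepth-replicate-zero (suc n) = cong (λ b → signedDepth b (suc n)) (last-replicate zero n)

  signedDepth-replicate-suc : ∀ i n → signedDepth (last (replicate n (suc i))) n ≡ d ∸ n
  signedDepth-replicate-suc i zero    = refl
  signedDepth-replicate-suc i (suc n) = cong (λ b → signedDepth b (suc n)) (last-replicate (suc i) n)

  potential-leaf-zero : potential (leaf zero) ≡ d + d
  potential-leaf-zero = begin
    signedDepth (last (replicate d zero)) (length (replicate d zero))
      ≡⟨ cong (signedDepth (last (replicate d zero))) (length-replicate d) ⟩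
    signedDepth (last (replicate d zero)) d
      ≡⟨ signedDepth-replicate-zero d ⟩
    d + d ∎
    where open ≡-Reasoning

  potential-leaf-suc : ∀ i → potential (leaf (suc i)) ≡ 0
  potential-leaf-suc i = begin
    signedDepth (last (replicate d (suc i))) (length (replicate d (suc i)))
      ≡⟨ cong (signedDepth (last (replicate d (suc i)))) (length-replicate d) ⟩
    signedDepth (last (replicate d (suc i))) d
      ≡⟨ signedDepth-replicate-suc i d ⟩
    d ∸ d
      ≡⟨ n∸n≡0 d ⟩
    0 ∎
    where open ≡-Reasoning

  leaves-far-apart : ∀ k i → k < 2 * d → ¬ DistLE (PerfectTree (suc m) d) k (leaf zero) (leaf (suc i))
  leaves-far-apart k i k<2d (n , n≤k , walk) = <⇒≱ k<2d (begin
    2 * d                        ≡⟨ cong (d +_) (+-identityʳ d) ⟩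
    d + d                        ≡⟨ potential-leaf-zero ⟨
    potential (leaf zero)        ≤⟨ walk-potential potential (λ {x} {y} → potential-adj {x} {y}) walk ⟩
    n + potential (leaf (suc i)) ≡⟨ cong (n +_) (potential-leaf-suc i) ⟩
    n + 0                        ≡⟨ +-identityʳ n ⟩
    n                            ≤⟨ n≤k ⟩
    k                            ∎)
    where open ≤-Reasoning

proposition5 : ∀ (m k d : ℕ) → 2 ≤ m → 2 ≤ k → d ≤ k →
    ((2 * d ≤ k → EternalDomNumber≡ (PerfectTree m d) k 1)
    × (2 * d > k → EternalDomNumber≡ (PerfectTree m d) k 2))
proposition5 (suc (suc m)) k d _ _ d≤k =
  (λ 2d≤k → eternalDomNumber≡1 root (eternalFamily₁ root (distLE-diameter k 2d≤k)))
  , (λ 2d>k → eternalDomNumber≡2 root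
       (eternalFamily₂ root (distLE-from-root k d≤k) (distLE-to-root k d≤k))
       (noEternalFamily₁ (leaf zero) (leaf (suc zero)) (leaves-far-apart k zero 2d>k)))
  where
  open EternalFamilies (PerfectTree (suc (suc m)) d) k
  open PerfectTreeDistances (suc (suc m)) d
  open SignedDepth (suc m) d
proposition5 (suc zero) _ _ (s≤s ()) _ _
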